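{- Let $I=(i_1,\dots,i_r)$ and $J=(j_1,\dots,j_s)$ be compositions (with $r,s\ge1$). Then $$R_I\#R_J=R_{(i_1,\dots,i_{r-1},\ i_r+j_1-1,\ j_2,\dots,j_s)}.$$
   Context: Let $A=\{a_1<a_2<\cdots\}$ be an infinite totally ordered alphabet and $\mathbb{K}$ a field; work with formal $\mathbb{K}$-linear combinations of nonempty words over $A$. The $\#$ product of words is $(ux)\#(yv)=uxv$ if the letters $x,y$ are equal and $0$ otherwise ($u,v$ words, $x,y$ letters), extended bilinearly. A word $w=w_1\cdots w_n$ has a descent at $i$ ($1\le i<n$) if $w_i>w_{i+1}$. For a composition $I=(i_1,\dots,i_r)$ of $n$ (positive integers summing to $n$), $R_I$ is the sum of all words $w$ of length $n$ over $A$ whose descent set is exactly $\{i_1,\ i_1+i_2,\ \dots,\ i_1+\cdots+i_{r-1}\}$. -}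

module Defs where

open import Level using (Level; _⊔_) renaming (suc to lsuc)
open import Data.Nat using (ℕ; zero; suc; _∸_; _<_; _<?_)
open import Data.Nat.ListAction using (sum)
open import Data.Bool using (Bool; true; false; _∧_; if_then_else_)
open import Data.List using (List; []; _∷_; map; length; foldr; _++_)
open import Data.List.Properties using (≡-dec)
open import Data.List.NonEmpty using (List⁺; _∷_; toList; [_]; head; tail; last; _∷⁺_)
import Data.List.NonEmpty as L⁺
open import Data.Product using (_×_; _,_; Σ)
open import Data.Empty using (⊥)
open import Relation.Nullary using (¬_; does)
open import Relation.Binary.PropositionalEquality using (_≡_)
open import Algebra.Bundles using (CommutativeRing)
import Data.Nat as ℕ
open import Data.List.Relation.Unary.All using (All)

record Field (c ℓ : Level) : Set (lsuc (c ⊔ ℓ)) where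
  field
    commutativeRing : CommutativeRing c ℓ
  open CommutativeRing commutativeRing public
  field
    1≉0     : ¬ (1# ≈ 0#)
    inverse : ∀ x → ¬ (x ≈ 0#) → Σ Carrier (λ y → x * y ≈ 1#)

-- The alphabet A = {a_1 < a_2 < ...} is identified with ℕ with its usual order.
-- Nonempty words over A:
Word : Set
Word = List⁺ ℕ

descentsFrom : ℕ → List ℕ → List ℕ
descentsFrom i []           = []
descentsFrom i (x ∷ [])     = []
descentsFrom i (x ∷ y ∷ ys) =
  let rest = descentsFrom (suc i) (y ∷ ys)
  in if does (y <? x) then i ∷ rest else rest

descents : Word → List ℕ
descents w = descentsFrom 1 (toList w)

Composition : Set
Composition = List⁺ ℕ

IsComposition : Composition → Set
IsComposition I = All (0 <_) (toList I)

-- Descent set of a composition (i_1,...,i_r): {i_1, i_1+i_2, ..., i_1+...+i_{r-1}},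
-- listed in increasing order.
partialSumsFrom : ℕ → ℕ → List ℕ → List ℕ
partialSumsFrom acc i []       = []
partialSumsFrom acc i (j ∷ js) = (acc ℕ.+ i) ∷ partialSumsFrom (acc ℕ.+ i) j js

descentSetOf : Composition → List ℕ
descentSetOf (i ∷ is) = partialSumsFrom 0 i is

size : Composition → ℕ
size I = sum (toList I)

-- Formal (possibly infinite) K-linear combinations of nonempty words:
-- a coefficient for every nonempty word.
module Series {c ℓ : Level} (K : Field c ℓ) where
  open Field K

  Ser : Set c
  Ser = Word → Carrier

  _≋_ : Ser → Ser → Set ℓ
  f ≋ g = ∀ w → f w ≈ g w

  -- All pairs of words (u , v) with u # v = w (as words):
  -- (u x) # (x v') = u x v'.  For w = w_1...w_n these are exactly
  -- u = w_1...w_k, v = w_k...w_n for k = 1..n.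
  splitsAux : ℕ → List ℕ → List (Word × Word)
  splitsAux x []       = ([ x ] , (x ∷ [])) ∷ []
  splitsAux x (y ∷ ys) = ([ x ] , (x ∷ y ∷ ys))
                         ∷ map (λ p → (x ∷⁺ Data.Product.proj₁ p , Data.Product.proj₂ p)) (splitsAux y ys)

  splits : Word → List (Word × Word)
  splits (x ∷ xs) = splitsAux x xs

  sumK : List Carrier → Carrier
  sumK = foldr _+_ 0#

  _#_ : Ser → Ser → Ser
  (f # g) w = sumK (map (λ p → f (Data.Product.proj₁ p) * g (Data.Product.proj₂ p)) (splits w))

  R : Composition → Ser
  R I w = if does (length (toList w) ℕ.≟ size I) ∧ does (≡-dec ℕ._≟_ (descents w) (descentSetOf I))
          then 1# else 0#

glueAux : ℕ → List ℕ → Composition → Composition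
glueAux i []        (j ∷ js) = (i ℕ.+ j ∸ 1) ∷ js
glueAux i (i' ∷ is) J        = i ∷⁺ glueAux i' is J

glue : Composition → Composition → Composition
glue (i ∷ is) J = glueAux i is J

-- Of the splittings w = u # v of a word, only the one where u has |I| letters can
-- contribute to the coefficient of w in R_I # R_J.  Writing w = P z Q with |P| = |I| - 1,
-- so that u = P z and v = z Q, the descent set of w is that of P z followed by that of
-- z Q shifted by |P|, and the descent set of the glued composition is that of I followed
-- by that of J shifted by |I| - 1.  The descents of P z lie below |I| and the shifted
-- ones above, so the two descent sets agree exactly when both halves agree.
module Submission where

open import Defs
open import Level using (Level)
open import Function using (_∘_; _⇔_; mk⇔)
open import Data.Nat using (ℕ; zero; suc; _+_; _∸_; _<_; _≤_; _<?_; _≤?_; _≟_; z≤n; s≤s; s<s⁻¹; z<s)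
open import Data.Nat.Properties
  using (+-suc; +-identityʳ; +-comm; +-assoc; +-cancelˡ-≡; suc-injective; ≤-refl; ≤-reflexive; ≤-trans;
         n≤1+n; m≤m+n; m<m+n; <⇒≱; ≤⇒≯; ≰⇒>)
open import Data.Nat.ListAction using (sum)
open import Data.Bool using (Bool; true; false; _∧_; if_then_else_)
open import Data.List using (List; []; _∷_; map; length; _++_)
open import Data.List.Properties using (≡-dec; map-∘; map-injective; length-++; ∷-injective)
open import Data.List.NonEmpty using (_∷_; head; tail; toList; [_]; _∷⁺_)
open import Data.List.Relation.Unary.All as All using (All; []; _∷_)
open import Data.List.Relation.Unary.All.Properties using (map⁺)
open import Data.Product using (_×_; _,_; proj₁; proj₂; ∃; map₁)
open import Relation.Nullary using (Dec; yes; no; does; contradiction)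
open import Relation.Nullary.Decidable using (_×-dec_; dec-false; does-⇔)
open import Relation.Binary.PropositionalEquality
  using (_≡_; _≢_; refl; sym; trans; cong; cong₂; subst; subst₂; module ≡-Reasoning)

All-if : ∀ {P : ℕ → Set} b {x xs} → P x → All P xs → All P (if b then x ∷ xs else xs)
All-if true  px pxs = px ∷ pxs
All-if false px pxs = pxs

++-cancel-separated : ∀ m {A B C D : List ℕ} →
  All (_< m) A → All (_< m) C → All (m ≤_) B → All (m ≤_) D →
  A ++ B ≡ C ++ D → A ≡ C × B ≡ D
++-cancel-separated m []          []          _   _   eq   = refl , eq
++-cancel-separated m []          (c<m ∷ _)   B≥m _   refl = contradiction (All.head B≥m) (<⇒≱ c<m)
++-cancel-separated m (a<m ∷ _)   []          _   D≥m refl = contradiction (All.head D≥m) (<⇒≱ a<m)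
++-cancel-separated m (_ ∷ A<m)   (_ ∷ C<m)   B≥m D≥m eq   with ∷-injective eq
... | refl , eq′ with ++-cancel-separated m A<m C<m B≥m D≥m eq′
...   | refl , B≡D = refl , B≡D

descentsFrom-shift : ∀ c i L → descentsFrom (c + i) L ≡ map (c +_) (descentsFrom i L)
descentsFrom-shift c i []          = refl
descentsFrom-shift c i (x ∷ [])    = refl
descentsFrom-shift c i (x ∷ y ∷ L) with descentsFrom-shift c (suc i) (y ∷ L)
... | ih rewrite sym (+-suc c i) | ih with does (y <? x)
...   | true  = refl
...   | false = refl

descentsFrom-++ : ∀ i P z Q →
  descentsFrom i (P ++ z ∷ Q) ≡ descentsFrom i (P ++ z ∷ []) ++ descentsFrom (i + length P) (z ∷ Q)
descentsFrom-++ i []           z Q rewrite +-identityʳ i = refl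
descentsFrom-++ i (p ∷ [])     z Q rewrite +-comm i 1 with does (z <? p)
... | true  = refl
... | false = refl
descentsFrom-++ i (p ∷ q ∷ P) z Q
  rewrite descentsFrom-++ (suc i) (q ∷ P) z Q | +-suc i (suc (length P)) with does (q <? p)
... | true  = refl
... | false = refl

descents-++ : ∀ P z Q →
  descentsFrom 1 (P ++ z ∷ Q) ≡ descentsFrom 1 (P ++ z ∷ []) ++ map (length P +_) (descentsFrom 1 (z ∷ Q))
descents-++ P z Q
  rewrite descentsFrom-++ 1 P z Q | +-comm 1 (length P) | descentsFrom-shift (length P) 1 (z ∷ Q) = refl

descentsFrom-≥ : ∀ i L → All (i ≤_) (descentsFrom i L)
descentsFrom-≥ i []          = []
descentsFrom-≥ i (x ∷ [])    = []
descentsFrom-≥ i (x ∷ y ∷ L) =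
  All-if (does (y <? x)) ≤-refl (All.map (≤-trans (n≤1+n i)) (descentsFrom-≥ (suc i) (y ∷ L)))

descentsFrom-< : ∀ i L → All (λ e → suc e < i + length L) (descentsFrom i L)
descentsFrom-< i []          = []
descentsFrom-< i (x ∷ [])    = []
descentsFrom-< i (x ∷ y ∷ L) with descentsFrom-< (suc i) (y ∷ L)
... | ih rewrite +-suc i (suc (length L)) = All-if (does (y <? x)) (s≤s (m<m+n i z<s)) ih

partialSumsFrom-cong : ∀ {a b a′ b′} js → a + b ≡ a′ + b′ → partialSumsFrom a b js ≡ partialSumsFrom a′ b′ js
partialSumsFrom-cong []       _  = refl
partialSumsFrom-cong (j ∷ js) eq rewrite eq = refl

partialSumsFrom-shift : ∀ c a j js → partialSumsFrom (c + a) j js ≡ map (c +_) (partialSumsFrom a j js)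
partialSumsFrom-shift c a j []        = refl
partialSumsFrom-shift c a j (j′ ∷ js) with partialSumsFrom-shift c (a + j) j′ js
... | ih rewrite +-assoc c a j = cong ((c + (a + j)) ∷_) ih

partialSumsFrom≡map : ∀ c j js → partialSumsFrom c j js ≡ map (c +_) (descentSetOf (j ∷ js))
partialSumsFrom≡map c j js =
  trans (cong (λ a → partialSumsFrom a j js) (sym (+-identityʳ c))) (partialSumsFrom-shift c 0 j js)

partialSumsFrom-≥ : ∀ acc i is → All (acc + i ≤_) (partialSumsFrom acc i is)
partialSumsFrom-≥ acc i []       = []
partialSumsFrom-≥ acc i (j ∷ js) =
  ≤-refl ∷ All.map (≤-trans (m≤m+n (acc + i) j)) (partialSumsFrom-≥ (acc + i) j js)

partialSumsFrom-< : ∀ acc i is → All (0 <_) is → All (_< acc + i + sum is) (partialSumsFrom acc i is)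
partialSumsFrom-< acc i []       []           = []
partialSumsFrom-< acc i (j ∷ js) (j>0 ∷ js>0) =
  m<m+n (acc + i) (≤-trans j>0 (m≤m+n j (sum js)))
  ∷ subst (λ n → All (_< n) (partialSumsFrom (acc + i) j js))
          (+-assoc (acc + i) j (sum js)) (partialSumsFrom-< (acc + i) j js js>0)

-- The hypothesis makes the truncated ∸ 1 an honest predecessor.
partialSumsFrom-glueAux : ∀ acc i is j js → 1 ≤ acc + i →
  let G = glueAux i is (suc j ∷ js) in
  partialSumsFrom acc (head G) (tail G)
    ≡ partialSumsFrom acc i is ++ partialSumsFrom (acc + sum (i ∷ is) ∸ 1) (suc j) js
partialSumsFrom-glueAux acc i [] j js acc+i≥1 = partialSumsFrom-cong js (begin
  acc + (i + suc j ∸ 1)      ≡⟨ cong (λ n → acc + (n ∸ 1)) (+-suc i j) ⟩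
  acc + (i + j)              ≡⟨ +-assoc acc i j ⟨
  acc + i + j                ≡⟨ pred-+-suc acc+i≥1 ⟨
  acc + i ∸ 1 + suc j        ≡⟨ cong (λ n → acc + n ∸ 1 + suc j) (+-identityʳ i) ⟨
  acc + (i + 0) ∸ 1 + suc j  ∎)
  where
  open ≡-Reasoning
  pred-+-suc : ∀ {n} → 1 ≤ n → n ∸ 1 + suc j ≡ n + j
  pred-+-suc {suc n} _ = +-suc n j
partialSumsFrom-glueAux acc i (i′ ∷ is) j js acc+i≥1
  with partialSumsFrom-glueAux (acc + i) i′ is j js (≤-trans acc+i≥1 (m≤m+n (acc + i) i′))
... | ih rewrite sym (+-assoc acc i (i′ + sum is)) = cong ((acc + i) ∷_) ih

descentSetOf-glue : ∀ i is j js →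
  descentSetOf (glue (suc i ∷ is) (suc j ∷ js))
    ≡ descentSetOf (suc i ∷ is) ++ map (i + sum is +_) (descentSetOf (suc j ∷ js))
descentSetOf-glue i is j js =
  trans (partialSumsFrom-glueAux 0 (suc i) is j js (s≤s z≤n))
        (cong (descentSetOf (suc i ∷ is) ++_) (partialSumsFrom≡map (i + sum is) (suc j) js))

size-glue : ∀ i is j js → size (glue (i ∷ is) (suc j ∷ js)) ≡ size (i ∷ is) + (j + sum js)
size-glue i []        j js rewrite +-identityʳ i | +-suc i j = +-assoc i j (sum js)
size-glue i (i′ ∷ is) j js =
  trans (cong (i +_) (size-glue i′ is j js)) (sym (+-assoc i (i′ + sum is) (j + sum js)))

HasShape : Composition → List ℕ → Set
HasShape I L = length L ≡ size I × descentsFrom 1 L ≡ descentSetOf I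

hasShape? : ∀ I L → Dec (HasShape I L)
hasShape? I L = (length L ≟ size I) ×-dec (≡-dec _≟_ (descentsFrom 1 L) (descentSetOf I))

ShapesGlue : Composition → Composition → List ℕ → List ℕ → List ℕ → Set
ShapesGlue I J u v w = (HasShape I u × HasShape J v) ⇔ HasShape (glue I J) w

shapesGlue-++ : ∀ {i is j js} P z Q → All (0 <_) is → length P ≡ i + sum is →
  ShapesGlue (suc i ∷ is) (suc j ∷ js) (P ++ z ∷ []) (z ∷ Q) (P ++ z ∷ Q)
shapesGlue-++ {i} {is} {j} {js} P z Q is>0 |P|≡k = mk⇔
  (λ ((_ , descPz) , (|zQ| , desczQ)) →
      trans |PzQ| (trans (cong (k +_) |zQ|) (sym size-G))
    , trans descents-PzQ (trans (cong₂ (λ D E → D ++ map (k +_) E) descPz desczQ) (sym desc-G)))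
  (λ (|PzQ|≡ , descPzQ) →
    let descPz , k+desczQ = ++-cancel-separated (suc k) below-Pz below-I above-zQ above-J
                              (trans (sym descents-PzQ) (trans descPzQ desc-G))
    in (|Pz| , descPz)
     , (+-cancelˡ-≡ k _ _ (trans (sym |PzQ|) (trans |PzQ|≡ size-G))
       , map-injective (+-cancelˡ-≡ k _ _) k+desczQ))
  where
  k : ℕ
  k = i + sum is
  I J G : Composition
  I = suc i ∷ is
  J = suc j ∷ js
  G = glue I J

  |Pz| : length (P ++ z ∷ []) ≡ size I
  |Pz| = trans (length-++ P) (trans (cong (_+ 1) |P|≡k) (+-comm k 1))

  |PzQ| : length (P ++ z ∷ Q) ≡ k + length (z ∷ Q)
  |PzQ| = trans (length-++ P) (cong (_+ length (z ∷ Q)) |P|≡k)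

  size-G : size G ≡ k + size J
  size-G = trans (size-glue (suc i) is j js) (sym (+-suc k (j + sum js)))

  descents-PzQ : descentsFrom 1 (P ++ z ∷ Q)
    ≡ descentsFrom 1 (P ++ z ∷ []) ++ map (k +_) (descentsFrom 1 (z ∷ Q))
  descents-PzQ rewrite sym |P|≡k = descents-++ P z Q

  desc-G : descentSetOf G ≡ descentSetOf I ++ map (k +_) (descentSetOf J)
  desc-G = descentSetOf-glue i is j js

  below-Pz : All (_< suc k) (descentsFrom 1 (P ++ z ∷ []))
  below-Pz = All.map (λ {e} e+1< → s<s⁻¹ (subst (λ n → suc e < suc n) |Pz| e+1<))
                     (descentsFrom-< 1 (P ++ z ∷ []))

  below-I : All (_< suc k) (descentSetOf I)
  below-I = partialSumsFrom-< 0 (suc i) is is>0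

  above-zQ : All (suc k ≤_) (map (k +_) (descentsFrom 1 (z ∷ Q)))
  above-zQ = map⁺ (All.map (m<m+n k) (descentsFrom-≥ 1 (z ∷ Q)))

  above-J : All (suc k ≤_) (map (k +_) (descentSetOf J))
  above-J = map⁺ (All.map (m<m+n k ∘ ≤-trans (s≤s z≤n)) (partialSumsFrom-≥ 0 (suc j) js))

-- For w = x ∷ ys, the entry of splitsAux x ys whose first word has k + 1 letters
-- (the last entry when w is too short).
splitAfter : ℕ → ℕ → List ℕ → Word × Word
splitAfter zero    x ys       = [ x ] , x ∷ ys
splitAfter (suc k) x []       = [ x ] , x ∷ []
splitAfter (suc k) x (y ∷ ys) = map₁ (x ∷⁺_) (splitAfter k y ys)

splitAfter-length-≤ : ∀ k x ys → length (toList (proj₁ (splitAfter k x ys))) ≤ suc (length ys)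
splitAfter-length-≤ zero    x ys       = s≤s z≤n
splitAfter-length-≤ (suc k) x []       = s≤s z≤n
splitAfter-length-≤ (suc k) x (y ∷ ys) = s≤s (splitAfter-length-≤ k y ys)

splitAfter-decomposition : ∀ k x ys → k ≤ length ys →
  ∃ λ P → ∃ λ z → ∃ λ Q → length P ≡ k × x ∷ ys ≡ P ++ z ∷ Q
    × toList (proj₁ (splitAfter k x ys)) ≡ P ++ z ∷ [] × toList (proj₂ (splitAfter k x ys)) ≡ z ∷ Q
splitAfter-decomposition zero    x ys       _        = [] , x , ys , refl , refl , refl , refl
splitAfter-decomposition (suc k) x (y ∷ ys) (s≤s k≤) with splitAfter-decomposition k y ys k≤
... | P , z , Q , |P|≡k , w≡ , u≡ , v≡ = x ∷ P , z , Q , cong suc |P|≡k , cong (x ∷_) w≡ , cong (x ∷_) u≡ , v≡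

shapesGlue-splitAfter : ∀ {i is j js} → All (0 <_) is → ∀ x ys →
  let u , v = splitAfter (i + sum is) x ys in
  ShapesGlue (suc i ∷ is) (suc j ∷ js) (toList u) (toList v) (x ∷ ys)
shapesGlue-splitAfter {i} {is} {j} {js} is>0 x ys with i + sum is ≤? length ys
... | yes k≤ with splitAfter-decomposition (i + sum is) x ys k≤
...   | P , z , Q , |P|≡k , w≡ , u≡ , v≡ =
  subst₂ (λ u v → ShapesGlue (suc i ∷ is) (suc j ∷ js) u v (x ∷ ys)) (sym u≡) (sym v≡)
    (subst (ShapesGlue (suc i ∷ is) (suc j ∷ js) (P ++ z ∷ []) (z ∷ Q)) (sym w≡) (shapesGlue-++ P z Q is>0 |P|≡k))
shapesGlue-splitAfter {i} {is} {j} {js} is>0 x ys | no k≰ = mk⇔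
  (λ ((|u|≡ , _) , _) →
    w-too-short (subst (_≤ suc (length ys)) |u|≡ (splitAfter-length-≤ (i + sum is) x ys)))
  (λ (|w|≡ , _) →
    w-too-short (≤-trans (m≤m+n (suc (i + sum is)) (j + sum js))
                         (≤-reflexive (sym (trans |w|≡ (size-glue (suc i) is j js))))))
  where
  w-too-short : ∀ {A : Set} → suc (i + sum is) ≤ suc (length ys) → A
  w-too-short = contradiction (s≤s (≰⇒> k≰)) ∘ ≤⇒≯

module _ {c ℓ : Level} (K : Field c ℓ) where
  private module K = Field K
  open Series K
  open import Relation.Binary.Reasoning.Setoid K.setoid

  -- R I w unfolds definitionally to indicator (does (hasShape? I (toList w))).
  indicator : Bool → K.Carrier
  indicator b = if b then K.1# else K.0#

  indicator-∧ : ∀ a b → indicator a K.* indicator b K.≈ indicator (a ∧ b)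
  indicator-∧ true  b = K.*-identityˡ (indicator b)
  indicator-∧ false b = K.zeroˡ (indicator b)

  sumK-zero : ∀ {A : Set} (h : A → K.Carrier) L → (∀ p → h p K.≈ K.0#) → sumK (map h L) K.≈ K.0#
  sumK-zero h []      _   = K.refl
  sumK-zero h (p ∷ L) h≈0 = K.trans (K.+-cong (h≈0 p) (sumK-zero h L h≈0)) (K.+-identityˡ K.0#)

  sumK-splitsAux-∷ : ∀ x y ys (g : Word × Word → K.Carrier) →
    sumK (map g (splitsAux x (y ∷ ys)))
      ≡ g ([ x ] , x ∷ y ∷ ys) K.+ sumK (map (g ∘ map₁ (x ∷⁺_)) (splitsAux y ys))
  sumK-splitsAux-∷ x y ys g = cong (λ s → _ K.+ sumK s) (sym (map-∘ (splitsAux y ys)))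

  sumK-splitsAux : ∀ k x ys (g : Word × Word → K.Carrier) →
    (∀ u v → length (toList u) ≢ suc k → g (u , v) K.≈ K.0#) →
    sumK (map g (splitsAux x ys)) K.≈ g (splitAfter k x ys)
  sumK-splitsAux zero    x []       g _   = K.+-identityʳ _
  sumK-splitsAux (suc k) x []       g _   = K.+-identityʳ _
  sumK-splitsAux zero    x (y ∷ ys) g g≈0 = begin
    sumK (map g (splitsAux x (y ∷ ys)))
      ≡⟨ sumK-splitsAux-∷ x y ys g ⟩
    g ([ x ] , x ∷ y ∷ ys) K.+ sumK (map (g ∘ map₁ (x ∷⁺_)) (splitsAux y ys))
      ≈⟨ K.+-congˡ (sumK-zero _ (splitsAux y ys) (λ _ → g≈0 _ _ λ ())) ⟩
    g ([ x ] , x ∷ y ∷ ys) K.+ K.0#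
      ≈⟨ K.+-identityʳ _ ⟩
    g ([ x ] , x ∷ y ∷ ys) ∎
  sumK-splitsAux (suc k) x (y ∷ ys) g g≈0 = begin
    sumK (map g (splitsAux x (y ∷ ys)))
      ≡⟨ sumK-splitsAux-∷ x y ys g ⟩
    g ([ x ] , x ∷ y ∷ ys) K.+ sumK (map (g ∘ map₁ (x ∷⁺_)) (splitsAux y ys))
      ≈⟨ K.+-congʳ (g≈0 _ _ λ ()) ⟩
    K.0# K.+ sumK (map (g ∘ map₁ (x ∷⁺_)) (splitsAux y ys))
      ≈⟨ K.+-identityˡ _ ⟩
    sumK (map (g ∘ map₁ (x ∷⁺_)) (splitsAux y ys))
      ≈⟨ sumK-splitsAux k y ys (g ∘ map₁ (x ∷⁺_)) (λ u v |u|≢ → g≈0 _ _ (|u|≢ ∘ suc-injective)) ⟩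
    g (splitAfter (suc k) x (y ∷ ys)) ∎

  R#R≋R-glue : ∀ {i is j js} → All (0 <_) is →
    (R (suc i ∷ is) # R (suc j ∷ js)) ≋ R (glue (suc i ∷ is) (suc j ∷ js))
  R#R≋R-glue {i} {is} {j} {js} is>0 (x ∷ ys) = begin
    (R I # R J) (x ∷ ys)
      ≈⟨ sumK-splitsAux k x ys (λ (u , v) → R I u K.* R J v) vanishes ⟩
    R I u K.* R J v
      ≈⟨ indicator-∧ _ _ ⟩
    indicator (does (hasShape? I (toList u) ×-dec hasShape? J (toList v)))
      ≡⟨ cong indicator (does-⇔ (shapesGlue-splitAfter {i} {is} {j} {js} is>0 x ys)
                                (hasShape? I (toList u) ×-dec hasShape? J (toList v))
                                (hasShape? (glue I J) (x ∷ ys))) ⟩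
    R (glue I J) (x ∷ ys) ∎
    where
    I J : Composition
    I = suc i ∷ is
    J = suc j ∷ js
    k : ℕ
    k = i + sum is
    u v : Word
    u = proj₁ (splitAfter k x ys)
    v = proj₂ (splitAfter k x ys)

    vanishes : ∀ u′ v′ → length (toList u′) ≢ suc k → R I u′ K.* R J v′ K.≈ K.0#
    vanishes u′ _ |u′|≢ = K.trans
      (K.*-congʳ (K.reflexive (cong indicator (dec-false (hasShape? I (toList u′)) (|u′|≢ ∘ proj₁)))))
      (K.zeroˡ _)

mainTheorem8 : ∀ {c ℓ : Level} (K : Field c ℓ) (I J : Composition) →
    IsComposition I → IsComposition J →
    let open Series K in (R I # R J) ≋ R (glue I J)
mainTheorem8 K (zero  ∷ _)  _            (() ∷ _)    _
mainTheorem8 K (suc _ ∷ _)  (zero  ∷ _)  _           (() ∷ _)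
mainTheorem8 K (suc _ ∷ _)  (suc _ ∷ _)  (_ ∷ is>0)  _         = R#R≋R-glue K is>0
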